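{- The clairvoyance gap for scheduling on related machines is $\Theta(\sqrt m)$, where $m$ is the number of machines.
   Context: Scheduling (load balancing) on related machines: there are $m$ machines with speeds $s_i>0$ and a set of jobs with sizes $p_j\ge0$; assigning job $j$ to machine $i$ adds $p_j/s_i$ to the load of machine $i$, and the makespan is the maximum machine load. A non-clairvoyant algorithm has no prior knowledge of job sizes: it decides on which machine to place each job using only the current machine loads and speeds; after the algorithm assigns a job, an adversary chooses the job's realized size, which the algorithm then observes for subsequent decisions. The clairvoyance gap is the maximum (over instances with $m$ machines) ratio between the makespan of an optimal non-clairvoyant algorithm and the optimal makespan achievable by a clairvoyant offline algorithm that knows all jobs and their sizes in advance.
   Formalization: The machine speeds $s_i$ and the job sizes $p_j$ are rational. -}

module Defs where

open import Data.Nat using (ℕ; zero; suc)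
open import Data.Fin using (Fin; zero; suc; _≟_)
open import Data.List using (List; []; _∷_; length)
open import Data.Integer using (+_)
open import Data.Rational using (ℚ; 0ℚ; _+_; _÷_; _⊔_; _/_; Positive)
open import Data.Rational.Properties using (pos⇒nonZero)
open import Relation.Nullary using (yes; no)
open import Function using (_∘_)

ofℕ : ℕ → ℚ
ofℕ n = + n / 1

record Speeds (m : ℕ) : Set where
  field
    speed    : Fin m → ℚ
    positive : ∀ i → Positive (speed i)

open Speeds public

time : ∀ {m} → Speeds m → Fin m → ℚ → ℚ
time S i p = (p ÷ speed S i) {{pos⇒nonZero (speed S i) {{positive S i}}}}

-- maximum over the machines (all values considered are ≥ 0)
maxFin : ∀ {m} → (Fin m → ℚ) → ℚ
maxFin {zero}  f = 0ℚ
maxFin {suc m} f = f zero ⊔ maxFin (f ∘ suc)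

Loads : ℕ → Set
Loads m = Fin m → ℚ

-- a (deterministic) non-clairvoyant algorithm: picks a machine for the next
-- job using only the current machine loads (the speeds are fixed per instance)
Algorithm : ℕ → Set
Algorithm m = Loads m → Fin m

addLoad : ∀ {m} → Speeds m → Loads m → Fin m → ℚ → Loads m
addLoad S L i p k with k ≟ i
... | yes _ = L k + time S i p
... | no  _ = L k

-- run the algorithm on the job sequence; sizes are revealed after placement
run : ∀ {m} → Speeds m → Algorithm m → Loads m → List ℚ → Loads m
run S alg L []       = L
run S alg L (p ∷ ps) = run S alg (addLoad S L (alg L) p) ps

algMakespan : ∀ {m} → Speeds m → Algorithm m → List ℚ → ℚ
algMakespan S alg ps = maxFin (run S alg (λ _ → 0ℚ) ps)

Assignment : ℕ → List ℚ → Set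
Assignment m ps = Fin (length ps) → Fin m

loadOf : ∀ {m} → Speeds m → (ps : List ℚ) → Assignment m ps → Loads m
loadOf S []       σ i = 0ℚ
loadOf S (p ∷ ps) σ i with σ zero ≟ i
... | yes _ = time S i p + loadOf S ps (σ ∘ suc) i
... | no  _ = loadOf S ps (σ ∘ suc) i

makespan : ∀ {m} → Speeds m → (ps : List ℚ) → Assignment m ps → ℚ
makespan S ps σ = maxFin (loadOf S ps σ)

{-# OPTIONS --safe #-}
module Submission where

-- Upper bound. Fix t with m ≤ t² ≤ 4m and call a machine fast if its speed is at least 1/t of
-- the maximal speed sₘₐₓ. The slow machines have total speed below m·sₘₐₓ/t ≤ t·sₘₐₓ, so the
-- fast ones carry at least a 1/(1+t) fraction of the total speed, and the total work is at most
-- (1+t)·OPT times their total speed. Placing every job on the least loaded fast machine thus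
-- finds, by averaging, a machine of load at most (1+t)·OPT, and the job (of size at most
-- sₘₐₓ·OPT) takes at most t·OPT there: ALG ≤ (1+2t)·OPT.
--
-- Lower bound. Take one machine of speed t and m − 1 of speed 1. The adversary sends jobs of
-- size t as long as the algorithm uses the fast machine, at most m of them, and a single job of
-- size t² as soon as it uses a slow one. Offline every machine gets at most one job, so
-- OPT ≤ t, whereas the algorithm ends with load m on the fast machine or t² on a slow one;
-- as m ≤ t² ≤ 4m, either way m·OPT² ≤ 4·ALG².

module ClairvoyanceGap where

  open import Defs
  open import Algebra.Bundles using (CommutativeMonoid; CommutativeRing)
  import Algebra.Properties.CommutativeSemigroup as CommutativeSemigroupProperties
  open import Data.Empty using (⊥-elim)
  open import Data.Fin as Fin using (Fin; zero; suc; toℕ; fromℕ<; punchIn; _≟_)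
  import Data.Fin.Properties as Fin
  import Data.Integer as ℤ
  import Data.Integer.Properties as ℤ
  open import Data.List using (List; []; _∷_; foldr; filter; allFin)
  open import Data.List.Membership.Propositional.Properties using (∈-allFin; ∈-filter⁺)
  open import Data.List.Relation.Unary.All as All using (All; []; _∷_)
  open import Data.List.Relation.Unary.All.Properties using (all-filter)
  open import Data.Maybe using (nothing)
  open import Data.Nat as ℕ using (ℕ; zero; suc; z≤n; s≤s)
  import Data.Nat.Coprimality as Coprime
  import Data.Nat.Properties as ℕ
  open import Data.Nat.Tactic.RingSolver renaming (solve-∀ to ℕ-solve-∀)
  open import Data.Product using (∃; _×_; _,_)
  open import Data.Rational using (ℚ; 0ℚ; 1ℚ; _+_; _*_; _/_; 1/_; _≤_; _<_; mkℚ; Positive; NonZero; nonNegative)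
  import Data.Rational as ℚ
  open import Data.Rational.Properties hiding (_≟_)
  open import Data.Sum using (_⊎_; inj₁; inj₂)
  open import Data.Vec.Functional using (Vector; removeAt) renaming (_∷_ to _∷ᵥ_)
  open import Function using (_∘_)
  open import Level using (0ℓ)
  open import Relation.Binary.PropositionalEquality
  open import Relation.Binary.Bundles using (DecTotalOrder)
  open import Relation.Nullary using (Dec; yes; no)
  open import Tactic.RingSolver using (solve-∀)
  open import Tactic.RingSolver.Core.AlmostCommutativeRing using (AlmostCommutativeRing; fromCommutativeRing)
  open import Algebra.Properties.Semiring.Sum (CommutativeRing.semiring +-*-commutativeRing)
    using (sum; sum-syntax; sum-remove; sum-cong-≗; ∑-distrib-+; *-distribˡ-sum; *-distribʳ-sum)

  open import Data.List.Extrema (DecTotalOrder.totalOrder ≤-decTotalOrder)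
    using (argmin; argmax; f[argmin]≤f[xs]; argmin-all; f[xs]≤f[argmax])

  module +-comm-semigroup =
    CommutativeSemigroupProperties (CommutativeMonoid.commutativeSemigroup +-0-commutativeMonoid)
  module *-comm-semigroup =
    CommutativeSemigroupProperties (CommutativeMonoid.commutativeSemigroup *-1-commutativeMonoid)

  ℚ-ring : AlmostCommutativeRing 0ℓ 0ℓ
  ℚ-ring = fromCommutativeRing +-*-commutativeRing (λ _ → nothing)

  q+p*q≡[1+p]*q : ∀ p q → q + p * q ≡ (1ℚ + p) * q
  q+p*q≡[1+p]*q = solve-∀ ℚ-ring

  ofℕ≡mkℚ : ∀ n → ofℕ n ≡ mkℚ (ℤ.+ n) 0 (Coprime.sym (Coprime.1-coprimeTo n))
  ofℕ≡mkℚ n = normalize-coprime (Coprime.sym (Coprime.1-coprimeTo n))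

  ofℕ-nonNeg : ∀ n → 0ℚ ≤ ofℕ n
  ofℕ-nonNeg n rewrite ofℕ≡mkℚ n = nonNegative⁻¹ _

  ofℕ-suc : ∀ n → ofℕ (suc n) ≡ 1ℚ + ofℕ n
  ofℕ-suc n = begin
    ofℕ (suc n)
      -- on the normal form mkℚ (+ n) 0 _, the sum below computes to (+ 1 ℤ.+ + n ℤ.* + 1) / 1
      ≡⟨ cong (λ z → (ℤ.+ 1 ℤ.+ z) / 1) (ℤ.*-identityʳ (ℤ.+ n)) ⟨
    1ℚ + mkℚ (ℤ.+ n) 0 (Coprime.sym (Coprime.1-coprimeTo n))
      ≡⟨ cong (1ℚ +_) (ofℕ≡mkℚ n) ⟨
    1ℚ + ofℕ n
      ∎
    where open ≡-Reasoning

  ofℕ-+ : ∀ a b → ofℕ (a ℕ.+ b) ≡ ofℕ a + ofℕ b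
  ofℕ-+ zero    b = sym (+-identityˡ (ofℕ b))
  ofℕ-+ (suc a) b = begin
    ofℕ (suc (a ℕ.+ b))        ≡⟨ ofℕ-suc (a ℕ.+ b) ⟩
    1ℚ + ofℕ (a ℕ.+ b)         ≡⟨ cong (1ℚ +_) (ofℕ-+ a b) ⟩
    1ℚ + (ofℕ a + ofℕ b)       ≡⟨ +-assoc 1ℚ (ofℕ a) (ofℕ b) ⟨
    1ℚ + ofℕ a + ofℕ b         ≡⟨ cong (_+ ofℕ b) (ofℕ-suc a) ⟨
    ofℕ (suc a) + ofℕ b        ∎
    where open ≡-Reasoning

  ofℕ-* : ∀ a b → ofℕ (a ℕ.* b) ≡ ofℕ a * ofℕ b
  ofℕ-* zero    b = sym (*-zeroˡ (ofℕ b))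
  ofℕ-* (suc a) b = begin
    ofℕ (b ℕ.+ a ℕ.* b)        ≡⟨ ofℕ-+ b (a ℕ.* b) ⟩
    ofℕ b + ofℕ (a ℕ.* b)      ≡⟨ cong (ofℕ b +_) (ofℕ-* a b) ⟩
    ofℕ b + ofℕ a * ofℕ b      ≡⟨ q+p*q≡[1+p]*q (ofℕ a) (ofℕ b) ⟩
    (1ℚ + ofℕ a) * ofℕ b       ≡⟨ cong (_* ofℕ b) (ofℕ-suc a) ⟨
    ofℕ (suc a) * ofℕ b        ∎
    where open ≡-Reasoning

  ofℕ-mono-≤ : ∀ {a b} → a ℕ.≤ b → ofℕ a ≤ ofℕ b
  ofℕ-mono-≤ {b = b} z≤n = ofℕ-nonNeg b
  ofℕ-mono-≤ (s≤s {a} {b} a≤b) =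
    subst₂ _≤_ (sym (ofℕ-suc a)) (sym (ofℕ-suc b)) (+-monoʳ-≤ 1ℚ (ofℕ-mono-≤ a≤b))

  p≤p+q : ∀ p {q} → 0ℚ ≤ q → p ≤ p + q
  p≤p+q p {q} 0≤q = subst (_≤ p + q) (+-identityʳ p) (+-monoʳ-≤ p 0≤q)

  p≤q+p : ∀ p {q} → 0ℚ ≤ q → p ≤ q + p
  p≤q+p p {q} 0≤q = subst (p ≤_) (+-comm p q) (p≤p+q p 0≤q)

  -- Named as in Data.Nat (the left factor varies), unlike *-monoˡ-≤-nonNeg of Data.Rational.
  *-monoˡ-≤ : ∀ {r p q} → 0ℚ ≤ r → p ≤ q → p * r ≤ q * r
  *-monoˡ-≤ {r} 0≤r = *-monoʳ-≤-nonNeg r {{nonNegative 0≤r}}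

  *-monoʳ-≤ : ∀ {r p q} → 0ℚ ≤ r → p ≤ q → r * p ≤ r * q
  *-monoʳ-≤ {r} 0≤r = *-monoˡ-≤-nonNeg r {{nonNegative 0≤r}}

  *-nonNeg : ∀ {p q} → 0ℚ ≤ p → 0ℚ ≤ q → 0ℚ ≤ p * q
  *-nonNeg {p} {q} 0≤p 0≤q = subst (_≤ p * q) (*-zeroˡ q) (*-monoˡ-≤ 0≤q 0≤p)

  *-mono-≤ : ∀ {p q r s} → 0ℚ ≤ p → 0ℚ ≤ r → p ≤ q → r ≤ s → p * r ≤ q * s
  *-mono-≤ 0≤p 0≤r p≤q r≤s = ≤-trans (*-monoˡ-≤ 0≤r p≤q) (*-monoʳ-≤ (≤-trans 0≤p p≤q) r≤s)

  square-≤-scaled : ∀ {a q c C} → 0ℚ ≤ a → 0ℚ ≤ q → a ≤ c * q → c * c ≤ C → a * a ≤ C * (q * q)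
  square-≤-scaled {a} {q} {c} {C} 0≤a 0≤q a≤cq c²≤C = begin
    a * a                 ≤⟨ *-mono-≤ 0≤a 0≤a a≤cq a≤cq ⟩
    c * q * (c * q)       ≡⟨ *-comm-semigroup.interchange c q c q ⟩
    c * c * (q * q)       ≤⟨ *-monoˡ-≤ (*-nonNeg 0≤q 0≤q) c²≤C ⟩
    C * (q * q)           ∎
    where open ≤-Reasoning

  ∑-mono-≤ : ∀ {n} {f g : Vector ℚ n} → (∀ i → f i ≤ g i) → sum f ≤ sum g
  ∑-mono-≤ {zero}  _   = ≤-refl
  ∑-mono-≤ {suc n} f≤g = +-mono-≤ (f≤g zero) (∑-mono-≤ (f≤g ∘ suc))

  ∑-nonNeg : ∀ {n} {f : Vector ℚ n} → (∀ i → 0ℚ ≤ f i) → 0ℚ ≤ sum f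
  ∑-nonNeg {zero}  _   = ≤-refl
  ∑-nonNeg {suc n} 0≤f = +-mono-≤ (0≤f zero) (∑-nonNeg (0≤f ∘ suc))

  f≤∑ : ∀ {n} {f : Vector ℚ n} → (∀ i → 0ℚ ≤ f i) → ∀ j → f j ≤ sum f
  f≤∑ {suc n} {f} 0≤f j =
    subst (f j ≤_) (sym (sum-remove {i = j} f)) (p≤p+q (f j) (∑-nonNeg (0≤f ∘ punchIn j)))

  ∑-*-zeroʳ : ∀ {n} (f : Vector ℚ n) → ∑[ i < n ] (f i * 0ℚ) ≡ 0ℚ
  ∑-*-zeroʳ f = trans (sym (*-distribʳ-sum 0ℚ f)) (*-zeroʳ (sum f))

  ∑-const : ∀ n c → ∑[ i < n ] c ≡ ofℕ n * c
  ∑-const zero    c = sym (*-zeroˡ c)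
  ∑-const (suc n) c = begin
    c + ∑[ i < n ] c        ≡⟨ cong (c +_) (∑-const n c) ⟩
    c + ofℕ n * c           ≡⟨ q+p*q≡[1+p]*q (ofℕ n) c ⟩
    (1ℚ + ofℕ n) * c        ≡⟨ cong (_* c) (ofℕ-suc n) ⟨
    ofℕ (suc n) * c         ∎
    where open ≡-Reasoning

  ∑-update : ∀ {n} (f g : Vector ℚ n) j d → g j ≡ f j + d → (∀ k → k ≢ j → g k ≡ f k) →
             sum g ≡ sum f + d
  ∑-update {suc n} f g j d gj gk = begin
    sum g                          ≡⟨ sum-remove g ⟩
    g j + sum (removeAt g j)       ≡⟨ cong₂ _+_ gj (sum-cong-≗ (λ k → gk _ (Fin.punchInᵢ≢i j k))) ⟩
    f j + d + sum (removeAt f j)   ≡⟨ +-comm-semigroup.xy∙z≈xz∙y (f j) d _ ⟩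
    f j + sum (removeAt f j) + d   ≡⟨ cong (_+ d) (sum-remove f) ⟨
    sum f + d                      ∎
    where open ≡-Reasoning

  maxFin-nonNeg : ∀ {m} (f : Vector ℚ m) → 0ℚ ≤ maxFin f
  maxFin-nonNeg {zero}  f = ≤-refl
  maxFin-nonNeg {suc m} f = ≤-trans (maxFin-nonNeg (f ∘ suc)) (p≤q⊔p (f zero) _)

  f≤maxFin : ∀ {m} (f : Vector ℚ m) i → f i ≤ maxFin f
  f≤maxFin {suc m} f zero    = p≤p⊔q (f zero) _
  f≤maxFin {suc m} f (suc i) = ≤-trans (f≤maxFin (f ∘ suc) i) (p≤q⊔p (f zero) _)

  maxFin-lub : ∀ {m} {f : Vector ℚ m} {b} → 0ℚ ≤ b → (∀ i → f i ≤ b) → maxFin f ≤ b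
  maxFin-lub {zero}  0≤b f≤b = 0≤b
  maxFin-lub {suc m} 0≤b f≤b = ⊔-lub (f≤b zero) (maxFin-lub 0≤b (f≤b ∘ suc))

  module _ {m} (S : Speeds m) (i : Fin m) where
    private
      s = speed S i
      instance
        s-pos : Positive s
        s-pos = positive S i
        s-nonZero : NonZero s
        s-nonZero = pos⇒nonZero s
        1/s-pos : Positive (1/ s)
        1/s-pos = 1/pos⇒pos s

    speed-nonNeg : 0ℚ ≤ speed S i
    speed-nonNeg = <⇒≤ (positive⁻¹ s)

    speed*time : ∀ p → speed S i * time S i p ≡ p
    speed*time p = begin
      s * (p * 1/ s)    ≡⟨ *-comm-semigroup.x∙yz≈y∙xz s p (1/ s) ⟩
      p * (s * 1/ s)    ≡⟨ cong (p *_) (*-inverseʳ s) ⟩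
      p * 1ℚ            ≡⟨ *-identityʳ p ⟩
      p                 ∎
      where open ≡-Reasoning

    time-speed* : ∀ X → time S i (speed S i * X) ≡ X
    time-speed* X = begin
      s * X * 1/ s      ≡⟨ *-comm-semigroup.xy∙z≈y∙xz s X (1/ s) ⟩
      X * (s * 1/ s)    ≡⟨ cong (X *_) (*-inverseʳ s) ⟩
      X * 1ℚ            ≡⟨ *-identityʳ X ⟩
      X                 ∎
      where open ≡-Reasoning

    time-mono-≤ : ∀ {p q} → p ≤ q → time S i p ≤ time S i q
    time-mono-≤ = *-monoʳ-≤-nonNeg (1/ s) {{pos⇒nonNeg (1/ s)}}

    time-nonNeg : ∀ {p} → 0ℚ ≤ p → 0ℚ ≤ time S i p
    time-nonNeg {p} 0≤p = subst (_≤ time S i p) (*-zeroˡ (1/ s)) (time-mono-≤ 0≤p)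

    time-pos : ∀ {p} → 0ℚ < p → 0ℚ < time S i p
    time-pos {p} 0<p = subst (_< time S i p) (*-zeroˡ (1/ s)) (*-monoˡ-<-pos (1/ s) 0<p)

    ≤speed*⇒time≤ : ∀ {p X} → p ≤ speed S i * X → time S i p ≤ X
    ≤speed*⇒time≤ {X = X} p≤sX = ≤-trans (time-mono-≤ p≤sX) (≤-reflexive (time-speed* X))

    time≤⇒≤speed* : ∀ {p X} → time S i p ≤ X → p ≤ speed S i * X
    time≤⇒≤speed* {p} t≤X = subst (_≤ _) (speed*time p) (*-monoʳ-≤ speed-nonNeg t≤X)

  totalSize : List ℚ → ℚ
  totalSize = foldr _+_ 0ℚ

  totalSize-nonNeg : ∀ {ps} → All (0ℚ ≤_) ps → 0ℚ ≤ totalSize ps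
  totalSize-nonNeg []           = ≤-refl
  totalSize-nonNeg (0≤p ∷ 0≤ps) = +-mono-≤ 0≤p (totalSize-nonNeg 0≤ps)

  module _ {m} (S : Speeds m) where

    addLoad-≡ : ∀ L i p → addLoad S L i p i ≡ L i + time S i p
    addLoad-≡ L i p with i ≟ i
    ... | yes _   = refl
    ... | no  i≢i = ⊥-elim (i≢i refl)

    addLoad-≢ : ∀ L i p {k} → k ≢ i → addLoad S L i p k ≡ L k
    addLoad-≢ L i p {k} k≢i with k ≟ i
    ... | yes k≡i = ⊥-elim (k≢i k≡i)
    ... | no  _   = refl

    addLoad-≥ : ∀ L i {p} → 0ℚ ≤ p → ∀ k → L k ≤ addLoad S L i p k
    addLoad-≥ L i 0≤p k with k ≟ i
    ... | yes refl = p≤p+q (L k) (time-nonNeg S k 0≤p)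
    ... | no  _    = ≤-refl

    addLoad-≤ : ∀ {L i p b} → (∀ k → L k ≤ b) → L i + time S i p ≤ b → ∀ k → addLoad S L i p k ≤ b
    addLoad-≤ {i = i} L≤b Li+t≤b k with k ≟ i
    ... | yes refl = Li+t≤b
    ... | no  _    = L≤b k

    ∑-addLoad : ∀ (w : Vector ℚ m) L i p →
                ∑[ k < m ] (w k * addLoad S L i p k) ≡ ∑[ k < m ] (w k * L k) + w i * time S i p
    ∑-addLoad w L i p = ∑-update (λ k → w k * L k) (λ k → w k * addLoad S L i p k) i _
      (trans (cong (w i *_) (addLoad-≡ L i p)) (*-distribˡ-+ (w i) (L i) _))
      (λ k k≢i → cong (w k *_) (addLoad-≢ L i p k≢i))

    loadOf-∷ : ∀ p ps σ k → loadOf S (p ∷ ps) σ k ≡ addLoad S (loadOf S ps (σ ∘ suc)) (σ zero) p k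
    loadOf-∷ p ps σ k with σ zero ≟ k | k ≟ σ zero
    ... | yes refl | yes _   = +-comm (time S k p) (loadOf S ps (σ ∘ suc) k)
    ... | yes refl | no  k≢k = ⊥-elim (k≢k refl)
    ... | no  k≢k  | yes refl = ⊥-elim (k≢k refl)
    ... | no  _    | no  _    = refl

    loadOf-nonNeg : ∀ ps σ → All (0ℚ ≤_) ps → ∀ i → 0ℚ ≤ loadOf S ps σ i
    loadOf-nonNeg []       σ []           i = ≤-refl
    loadOf-nonNeg (p ∷ ps) σ (0≤p ∷ 0≤ps) i = begin
      0ℚ                                                 ≤⟨ loadOf-nonNeg ps (σ ∘ suc) 0≤ps i ⟩
      loadOf S ps (σ ∘ suc) i                            ≤⟨ addLoad-≥ _ (σ zero) 0≤p i ⟩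
      addLoad S (loadOf S ps (σ ∘ suc)) (σ zero) p i     ≡⟨ loadOf-∷ p ps σ i ⟨
      loadOf S (p ∷ ps) σ i                              ∎
      where open ≤-Reasoning

    ∑-speed*loadOf : ∀ ps σ → ∑[ i < m ] (speed S i * loadOf S ps σ i) ≡ totalSize ps
    ∑-speed*loadOf []       σ = ∑-*-zeroʳ (speed S)
    ∑-speed*loadOf (p ∷ ps) σ = begin
      ∑[ i < m ] (speed S i * loadOf S (p ∷ ps) σ i)
        ≡⟨ sum-cong-≗ (λ i → cong (speed S i *_) (loadOf-∷ p ps σ i)) ⟩
      ∑[ i < m ] (speed S i * addLoad S (loadOf S ps (σ ∘ suc)) (σ zero) p i)
        ≡⟨ ∑-addLoad (speed S) _ (σ zero) p ⟩
      ∑[ i < m ] (speed S i * loadOf S ps (σ ∘ suc) i) + speed S (σ zero) * time S (σ zero) p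
        ≡⟨ cong₂ _+_ (∑-speed*loadOf ps (σ ∘ suc)) (speed*time S (σ zero) p) ⟩
      totalSize ps + p
        ≡⟨ +-comm (totalSize ps) p ⟩
      p + totalSize ps
        ∎
      where open ≡-Reasoning

    time≤loadOf : ∀ p ps σ → All (0ℚ ≤_) ps → time S (σ zero) p ≤ loadOf S (p ∷ ps) σ (σ zero)
    time≤loadOf p ps σ 0≤ps = begin
      time S (σ zero) p
        ≤⟨ p≤q+p _ (loadOf-nonNeg ps (σ ∘ suc) 0≤ps (σ zero)) ⟩
      loadOf S ps (σ ∘ suc) (σ zero) + time S (σ zero) p
        ≡⟨ addLoad-≡ _ (σ zero) p ⟨
      addLoad S (loadOf S ps (σ ∘ suc)) (σ zero) p (σ zero)
        ≡⟨ loadOf-∷ p ps σ (σ zero) ⟨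
      loadOf S (p ∷ ps) σ (σ zero)
        ∎
      where open ≤-Reasoning

    jobs-fit : ∀ ps σ {X} → All (0ℚ ≤_) ps → (∀ i → loadOf S ps σ i ≤ X) →
               All (λ p → ∃ λ i → time S i p ≤ X) ps
    jobs-fit []       σ []           _    = []
    jobs-fit (p ∷ ps) σ (0≤p ∷ 0≤ps) load≤X =
      (σ zero , ≤-trans (time≤loadOf p ps σ 0≤ps) (load≤X (σ zero))) ∷
      jobs-fit ps (σ ∘ suc) 0≤ps (λ i → ≤-trans (tail≤ i) (load≤X i))
      where
      tail≤ : ∀ i → loadOf S ps (σ ∘ suc) i ≤ loadOf S (p ∷ ps) σ i
      tail≤ i = subst (loadOf S ps (σ ∘ suc) i ≤_) (sym (loadOf-∷ p ps σ i)) (addLoad-≥ _ (σ zero) 0≤p i)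

    makespan-pos : ∀ p ps σ → 0ℚ < p → All (0ℚ ≤_) ps → 0ℚ < makespan S (p ∷ ps) σ
    makespan-pos p ps σ 0<p 0≤ps = <-≤-trans (time-pos S (σ zero) 0<p)
      (≤-trans (time≤loadOf p ps σ 0≤ps) (f≤maxFin (loadOf S (p ∷ ps) σ) (σ zero)))

  module RestrictedGreedy {m} (S : Speeds (suc m)) (τ : ℚ) (1≤τ : 1ℚ ≤ τ)
                          (fastest : Fin (suc m)) (speed≤sₘₐₓ : ∀ i → speed S i ≤ speed S fastest) where

    0<τ : 0ℚ < τ
    0<τ = <-≤-trans (positive⁻¹ 1ℚ) 1≤τ

    0≤τ : 0ℚ ≤ τ
    0≤τ = <⇒≤ 0<τ

    sₘₐₓ : ℚ
    sₘₐₓ = speed S fastest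

    Fast : Fin (suc m) → Set
    Fast i = sₘₐₓ ≤ τ * speed S i

    fast? : ∀ i → Dec (Fast i)
    fast? i = sₘₐₓ ≤? τ * speed S i

    fastest-Fast : Fast fastest
    fastest-Fast = subst (_≤ τ * sₘₐₓ) (*-identityˡ sₘₐₓ) (*-monoˡ-≤ (speed-nonNeg S fastest) 1≤τ)

    fastMachines : List (Fin (suc m))
    fastMachines = filter fast? (allFin (suc m))

    greedy : Algorithm (suc m)
    greedy L = argmin L fastest fastMachines

    greedy-Fast : ∀ L → Fast (greedy L)
    greedy-Fast L = argmin-all L fastest-Fast (all-filter fast? (allFin (suc m)))

    greedy-least : ∀ L {i} → Fast i → L (greedy L) ≤ L i
    greedy-least L {i} fast =
      All.lookup (f[argmin]≤f[xs] {f = L} fastest fastMachines) (∈-filter⁺ fast? (∈-allFin i) fast)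

    fastSpeed : Fin (suc m) → ℚ
    fastSpeed i with fast? i
    ... | yes _ = speed S i
    ... | no  _ = 0ℚ

    fastSpeed-Fast : ∀ {i} → Fast i → fastSpeed i ≡ speed S i
    fastSpeed-Fast {i} fast with fast? i
    ... | yes _    = refl
    ... | no  slow = ⊥-elim (slow fast)

    fastSpeed-nonNeg : ∀ i → 0ℚ ≤ fastSpeed i
    fastSpeed-nonNeg i with fast? i
    ... | yes _ = speed-nonNeg S i
    ... | no  _ = ≤-refl

    τ*speed≤τ*fastSpeed+sₘₐₓ : ∀ i → τ * speed S i ≤ τ * fastSpeed i + sₘₐₓ
    τ*speed≤τ*fastSpeed+sₘₐₓ i with fast? i
    ... | yes _    = p≤p+q (τ * speed S i) (speed-nonNeg S fastest)
    ... | no  slow = subst (τ * speed S i ≤_) (sym (trans (cong (_+ sₘₐₓ) (*-zeroʳ τ)) (+-identityˡ sₘₐₓ)))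
                           (<⇒≤ (≰⇒> slow))

    fastTotal : ℚ
    fastTotal = sum fastSpeed

    sₘₐₓ≤fastTotal : sₘₐₓ ≤ fastTotal
    sₘₐₓ≤fastTotal = subst (_≤ fastTotal) (fastSpeed-Fast fastest-Fast) (f≤∑ fastSpeed-nonNeg fastest)

    fastTotal-pos : 0ℚ < fastTotal
    fastTotal-pos = <-≤-trans (positive⁻¹ sₘₐₓ {{positive S fastest}}) sₘₐₓ≤fastTotal

    fastWork : Loads (suc m) → ℚ
    fastWork L = ∑[ i < suc m ] (fastSpeed i * L i)

    fastWork-addLoad : ∀ L {r} p → Fast r → fastWork (addLoad S L r p) ≡ fastWork L + p
    fastWork-addLoad L {r} p fast = trans (∑-addLoad S fastSpeed L r p)
      (cong (fastWork L +_) (trans (cong (_* time S r p) (fastSpeed-Fast fast)) (speed*time S r p)))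

    fastTotal*greedy≤fastWork : ∀ L → fastTotal * L (greedy L) ≤ fastWork L
    fastTotal*greedy≤fastWork L = begin
      fastTotal * L (greedy L)                 ≡⟨ *-distribʳ-sum (L (greedy L)) fastSpeed ⟩
      ∑[ i < suc m ] (fastSpeed i * L (greedy L)) ≤⟨ ∑-mono-≤ termwise ⟩
      fastWork L                               ∎
      where
      open ≤-Reasoning
      termwise : ∀ i → fastSpeed i * L (greedy L) ≤ fastSpeed i * L i
      termwise i with fast? i
      ... | yes fast = *-monoʳ-≤ (speed-nonNeg S i) (greedy-least L fast)
      ... | no  _    = ≤-reflexive (trans (*-zeroˡ (L (greedy L))) (sym (*-zeroˡ (L i))))

    -- There are at most m ≤ τ² slow machines, each of speed below sₘₐₓ/τ ≤ fastTotal/τ.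
    totalSpeed≤ : ofℕ (suc m) ≤ τ * τ → sum (speed S) ≤ (1ℚ + τ) * fastTotal
    totalSpeed≤ m≤τ² = *-cancelˡ-≤-pos τ {{ℚ.positive 0<τ}} (begin
      τ * sum (speed S)
        ≡⟨ *-distribˡ-sum τ (speed S) ⟩
      ∑[ i < suc m ] (τ * speed S i)
        ≤⟨ ∑-mono-≤ τ*speed≤τ*fastSpeed+sₘₐₓ ⟩
      ∑[ i < suc m ] (τ * fastSpeed i + sₘₐₓ)
        ≡⟨ ∑-distrib-+ (λ i → τ * fastSpeed i) (λ _ → sₘₐₓ) ⟩
      ∑[ i < suc m ] (τ * fastSpeed i) + ∑[ i < suc m ] sₘₐₓ
        ≡⟨ cong₂ _+_ (sym (*-distribˡ-sum τ fastSpeed)) (∑-const (suc m) sₘₐₓ) ⟩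
      τ * fastTotal + ofℕ (suc m) * sₘₐₓ
        ≤⟨ +-monoʳ-≤ (τ * fastTotal) (*-mono-≤ (ofℕ-nonNeg (suc m)) (speed-nonNeg S fastest) m≤τ² sₘₐₓ≤fastTotal) ⟩
      τ * fastTotal + τ * τ * fastTotal
        ≡⟨ factor τ fastTotal ⟩
      τ * ((1ℚ + τ) * fastTotal)
        ∎)
      where
      open ≤-Reasoning
      factor : ∀ a b → a * b + a * a * b ≡ a * ((1ℚ + a) * b)
      factor = solve-∀ ℚ-ring

    -- As fastWork L + totalSize ps ≤ fastTotal · B, averaging puts the least loaded fast
    -- machine below B when the next job arrives; on that machine the job takes at most D.
    greedy-run-≤ : ∀ {B D} ps L → All (0ℚ ≤_) ps → All (λ p → ∀ {r} → Fast r → time S r p ≤ D) ps →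
                   fastWork L + totalSize ps ≤ fastTotal * B → (∀ i → L i ≤ B + D) →
                   ∀ i → run S greedy L ps i ≤ B + D
    greedy-run-≤ [] L _ _ _ L≤ = L≤
    greedy-run-≤ {B} {D} (p ∷ ps) L (0≤p ∷ 0≤ps) (p-fits ∷ ps-fit) work≤ L≤ =
      greedy-run-≤ ps (addLoad S L r p) 0≤ps ps-fit work′≤
        (addLoad-≤ S L≤ (+-mono-≤ Lr≤B (p-fits (greedy-Fast L))))
      where
      open ≤-Reasoning
      r = greedy L
      work′≤ : fastWork (addLoad S L r p) + totalSize ps ≤ fastTotal * B
      work′≤ = begin
        fastWork (addLoad S L r p) + totalSize ps
          ≡⟨ cong (_+ totalSize ps) (fastWork-addLoad L p (greedy-Fast L)) ⟩
        fastWork L + p + totalSize ps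
          ≡⟨ +-assoc (fastWork L) p (totalSize ps) ⟩
        fastWork L + totalSize (p ∷ ps)
          ≤⟨ work≤ ⟩
        fastTotal * B
          ∎
      Lr≤B : L r ≤ B
      Lr≤B = *-cancelˡ-≤-pos fastTotal {{ℚ.positive fastTotal-pos}} (begin
        fastTotal * L r                             ≤⟨ fastTotal*greedy≤fastWork L ⟩
        fastWork L                                  ≤⟨ p≤p+q (fastWork L) (totalSize-nonNeg (0≤p ∷ 0≤ps)) ⟩
        fastWork L + totalSize (p ∷ ps)             ≤⟨ work≤ ⟩
        fastTotal * B                               ∎)

    greedy-competitive : ofℕ (suc m) ≤ τ * τ → ∀ ps → All (0ℚ ≤_) ps → (σ : Assignment (suc m) ps) →
                         algMakespan S greedy ps ≤ (1ℚ + (τ + τ)) * makespan S ps σ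
    greedy-competitive m≤τ² ps 0≤ps σ = maxFin-lub (subst (0ℚ ≤_) B+D≡ 0≤B+D) run≤
      where
      open ≤-Reasoning
      Q = makespan S ps σ
      0≤Q : 0ℚ ≤ Q
      0≤Q = maxFin-nonNeg (loadOf S ps σ)

      fast-fit : ∀ {p} → (∃ λ i → time S i p ≤ Q) → ∀ {r} → Fast r → time S r p ≤ τ * Q
      fast-fit {p} (i , tᵢ≤Q) {r} fast = ≤speed*⇒time≤ S r (begin
        p                      ≤⟨ time≤⇒≤speed* S i tᵢ≤Q ⟩
        speed S i * Q          ≤⟨ *-monoˡ-≤ 0≤Q (speed≤sₘₐₓ i) ⟩
        sₘₐₓ * Q               ≤⟨ *-monoˡ-≤ 0≤Q fast ⟩
        τ * speed S r * Q      ≡⟨ *-comm-semigroup.xy∙z≈y∙xz τ (speed S r) Q ⟩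
        speed S r * (τ * Q)    ∎)

      initial-work≤ : fastWork (λ _ → 0ℚ) + totalSize ps ≤ fastTotal * ((1ℚ + τ) * Q)
      initial-work≤ = begin
        fastWork (λ _ → 0ℚ) + totalSize ps
          ≡⟨ trans (cong (_+ totalSize ps) (∑-*-zeroʳ fastSpeed)) (+-identityˡ (totalSize ps)) ⟩
        totalSize ps
          ≡⟨ ∑-speed*loadOf S ps σ ⟨
        ∑[ i < suc m ] (speed S i * loadOf S ps σ i)
          ≤⟨ ∑-mono-≤ (λ i → *-monoʳ-≤ (speed-nonNeg S i) (f≤maxFin (loadOf S ps σ) i)) ⟩
        ∑[ i < suc m ] (speed S i * Q)
          ≡⟨ *-distribʳ-sum Q (speed S) ⟨
        sum (speed S) * Q
          ≤⟨ *-monoˡ-≤ 0≤Q (totalSpeed≤ m≤τ²) ⟩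
        (1ℚ + τ) * fastTotal * Q
          ≡⟨ *-comm-semigroup.xy∙z≈y∙xz (1ℚ + τ) fastTotal Q ⟩
        fastTotal * ((1ℚ + τ) * Q)
          ∎

      0≤B+D : 0ℚ ≤ (1ℚ + τ) * Q + τ * Q
      0≤B+D = +-mono-≤ (*-nonNeg (+-mono-≤ (<⇒≤ (positive⁻¹ 1ℚ)) 0≤τ) 0≤Q) (*-nonNeg 0≤τ 0≤Q)

      B+D≡ : (1ℚ + τ) * Q + τ * Q ≡ (1ℚ + (τ + τ)) * Q
      B+D≡ = collect τ Q
        where
        collect : ∀ a b → (1ℚ + a) * b + a * b ≡ (1ℚ + (a + a)) * b
        collect = solve-∀ ℚ-ring

      run≤ : ∀ i → run S greedy (λ _ → 0ℚ) ps i ≤ (1ℚ + (τ + τ)) * Q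
      run≤ i = subst (run S greedy (λ _ → 0ℚ) ps i ≤_) B+D≡
        (greedy-run-≤ ps (λ _ → 0ℚ) 0≤ps jobs-fit-fast initial-work≤ (λ _ → 0≤B+D) i)
        where
        jobs-fit-fast : All (λ p → ∀ {r} → Fast r → time S r p ≤ τ * Q) ps
        jobs-fit-fast = All.map (λ {p} → fast-fit {p}) (jobs-fit S ps σ 0≤ps (f≤maxFin (loadOf S ps σ)))

  fastest-machine : ∀ {m} (S : Speeds (suc m)) → ∃ λ i → ∀ j → speed S j ≤ speed S i
  fastest-machine {m} S = argmax (speed S) zero (allFin (suc m)) ,
    λ j → All.lookup (f[xs]≤f[argmax] {f = speed S} zero (allFin (suc m))) (∈-allFin j)

  sqrt-bracket : ∀ m → ∃ λ t → 1 ℕ.≤ t × suc m ℕ.≤ t ℕ.* t × t ℕ.* t ℕ.≤ 4 ℕ.* suc m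
  sqrt-bracket zero = 1 , ℕ.≤-refl , ℕ.≤-refl , s≤s z≤n
  sqrt-bracket (suc m) with sqrt-bracket m
  ... | t , 1≤t , m<t² , t²≤4m with suc (suc m) ℕ.≤? t ℕ.* t
  ...   | yes m+1<t² = t , 1≤t , m+1<t² , ℕ.≤-trans t²≤4m (ℕ.*-monoʳ-≤ 4 (ℕ.n≤1+n (suc m)))
  ...   | no  m+1≮t² = t ℕ.+ t , ℕ.≤-trans 1≤t (ℕ.m≤m+n t t) ,
                       subst (suc (suc m) ℕ.≤_) (sym [2t]²≡4[m+1]) m+2≤4[m+1] ,
                       subst (ℕ._≤ 4 ℕ.* suc (suc m)) (sym [2t]²≡4[m+1]) (ℕ.*-monoʳ-≤ 4 (ℕ.n≤1+n (suc m)))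
    where
    double-square : ∀ n → (n ℕ.+ n) ℕ.* (n ℕ.+ n) ≡ 4 ℕ.* (n ℕ.* n)
    double-square = ℕ-solve-∀
    [2t]²≡4[m+1] : (t ℕ.+ t) ℕ.* (t ℕ.+ t) ≡ 4 ℕ.* suc m
    [2t]²≡4[m+1] = trans (double-square t)
      (cong (4 ℕ.*_) (ℕ.≤-antisym (ℕ.≤-pred (ℕ.≰⇒> m+1≮t²)) m<t²))
    m+2≤4[m+1] : suc (suc m) ℕ.≤ 4 ℕ.* suc m
    m+2≤4[m+1] = subst (ℕ._≤ 4 ℕ.* suc m) (ℕ.+-comm (suc m) 1) (ℕ.+-monoʳ-≤ (suc m) (s≤s z≤n))

  [1+2t]²≤36m : ∀ {t m} → 1 ℕ.≤ t → t ℕ.* t ℕ.≤ 4 ℕ.* m →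
                suc (t ℕ.+ t) ℕ.* suc (t ℕ.+ t) ℕ.≤ 6 ℕ.* 6 ℕ.* m
  [1+2t]²≤36m {t} {m} 1≤t t²≤4m = begin
    suc (t ℕ.+ t) ℕ.* suc (t ℕ.+ t)           ≤⟨ ℕ.*-mono-≤ 1+2t≤3t 1+2t≤3t ⟩
    (t ℕ.+ (t ℕ.+ t)) ℕ.* (t ℕ.+ (t ℕ.+ t))   ≡⟨ triple-square t ⟩
    9 ℕ.* (t ℕ.* t)                           ≤⟨ ℕ.*-monoʳ-≤ 9 t²≤4m ⟩
    9 ℕ.* (4 ℕ.* m)                           ≡⟨ ℕ.*-assoc 9 4 m ⟨
    6 ℕ.* 6 ℕ.* m                             ∎
    where
    open ℕ.≤-Reasoning
    1+2t≤3t : suc (t ℕ.+ t) ℕ.≤ t ℕ.+ (t ℕ.+ t)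
    1+2t≤3t = ℕ.+-monoˡ-≤ (t ℕ.+ t) 1≤t
    triple-square : ∀ n → (n ℕ.+ (n ℕ.+ n)) ℕ.* (n ℕ.+ (n ℕ.+ n)) ≡ 9 ℕ.* (n ℕ.* n)
    triple-square = ℕ-solve-∀

  ofℕ[1+2t]²≤36m : ∀ {t m} → 1 ℕ.≤ t → t ℕ.* t ℕ.≤ 4 ℕ.* m →
                   (1ℚ + (ofℕ t + ofℕ t)) * (1ℚ + (ofℕ t + ofℕ t)) ≤ ofℕ (6 ℕ.* 6 ℕ.* m)
  ofℕ[1+2t]²≤36m {t} {m} 1≤t t²≤4m =
    subst (_≤ ofℕ (6 ℕ.* 6 ℕ.* m))
          (trans (ofℕ-* (suc (t ℕ.+ t)) (suc (t ℕ.+ t))) (cong₂ _*_ ofℕ[1+2t] ofℕ[1+2t]))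
          (ofℕ-mono-≤ ([1+2t]²≤36m {m = m} 1≤t t²≤4m))
    where
    ofℕ[1+2t] : ofℕ (suc (t ℕ.+ t)) ≡ 1ℚ + (ofℕ t + ofℕ t)
    ofℕ[1+2t] = trans (ofℕ-suc (t ℕ.+ t)) (cong (1ℚ +_) (ofℕ-+ t t))

  upper-bound : ∀ m → 1 ℕ.≤ m → (S : Speeds m) → ∃ λ (alg : Algorithm m) →
               ∀ ps → All (0ℚ ≤_) ps → (σ : Assignment m ps) →
               algMakespan S alg ps * algMakespan S alg ps
                 ≤ ofℕ (6 ℕ.* 6 ℕ.* m) * (makespan S ps σ * makespan S ps σ)
  upper-bound (suc m) _ S =
    let t , 1≤t , m<t² , t²≤4m = sqrt-bracket m
        fastest , speed≤sₘₐₓ   = fastest-machine S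
        open RestrictedGreedy S (ofℕ t) (ofℕ-mono-≤ 1≤t) fastest speed≤sₘₐₓ
    in  greedy , λ ps 0≤ps σ →
          square-≤-scaled {c = 1ℚ + (ofℕ t + ofℕ t)}
            (maxFin-nonNeg (run S greedy (λ _ → 0ℚ) ps)) (maxFin-nonNeg (loadOf S ps σ))
            (greedy-competitive (subst (ofℕ (suc m) ≤_) (ofℕ-* t t) (ofℕ-mono-≤ m<t²)) ps 0≤ps σ)
            (ofℕ[1+2t]²≤36m {m = suc m} 1≤t t²≤4m)

  μ*q²≤4*a² : ∀ {μ τ q a} → 0ℚ ≤ μ → 0ℚ ≤ q → q ≤ τ → μ ≤ τ * τ → τ * τ ≤ ofℕ 4 * μ →
              τ * τ ≤ a ⊎ μ ≤ a → μ * (q * q) ≤ ofℕ 4 * (a * a)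
  μ*q²≤4*a² {μ} {τ} {q} {a} 0≤μ 0≤q q≤τ μ≤τ² τ²≤4μ alg-large = begin
    μ * (q * q)           ≤⟨ *-monoʳ-≤ 0≤μ (*-mono-≤ 0≤q 0≤q q≤τ q≤τ) ⟩
    μ * (τ * τ)           ≤⟨ large alg-large ⟩
    ofℕ 4 * (a * a)       ∎
    where
    open ≤-Reasoning
    0≤τ² : 0ℚ ≤ τ * τ
    0≤τ² = ≤-trans 0≤μ μ≤τ²
    large : τ * τ ≤ a ⊎ μ ≤ a → μ * (τ * τ) ≤ ofℕ 4 * (a * a)
    large (inj₁ τ²≤a) = begin
      μ * (τ * τ)         ≤⟨ *-monoˡ-≤ 0≤τ² μ≤τ² ⟩
      τ * τ * (τ * τ)     ≤⟨ *-mono-≤ 0≤τ² 0≤τ² τ²≤a τ²≤a ⟩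
      a * a               ≡⟨ *-identityˡ (a * a) ⟨
      1ℚ * (a * a)        ≤⟨ *-monoˡ-≤ 0≤a² (ofℕ-mono-≤ {1} {4} (s≤s z≤n)) ⟩
      ofℕ 4 * (a * a)     ∎
      where
      0≤a² : 0ℚ ≤ a * a
      0≤a² = *-nonNeg (≤-trans 0≤τ² τ²≤a) (≤-trans 0≤τ² τ²≤a)
    large (inj₂ μ≤a) = begin
      μ * (τ * τ)         ≤⟨ *-monoʳ-≤ 0≤μ τ²≤4μ ⟩
      μ * (ofℕ 4 * μ)     ≡⟨ *-comm-semigroup.x∙yz≈y∙xz μ (ofℕ 4) μ ⟩
      ofℕ 4 * (μ * μ)     ≤⟨ *-monoʳ-≤ (ofℕ-nonNeg 4) (*-mono-≤ 0≤μ 0≤μ μ≤a μ≤a) ⟩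
      ofℕ 4 * (a * a)     ∎

  module Adversary {m : ℕ} (τ : ℚ) (1≤τ : 1ℚ ≤ τ) where

    0<τ : 0ℚ < τ
    0<τ = <-≤-trans (positive⁻¹ 1ℚ) 1≤τ

    0≤τ : 0ℚ ≤ τ
    0≤τ = <⇒≤ 0<τ

    instance
      τ-pos : Positive τ
      τ-pos = ℚ.positive 0<τ

    oneFastSpeeds : Fin (suc m) → ℚ
    oneFastSpeeds zero    = τ
    oneFastSpeeds (suc _) = 1ℚ

    oneFastSpeeds-pos : ∀ i → Positive (oneFastSpeeds i)
    oneFastSpeeds-pos zero    = τ-pos
    oneFastSpeeds-pos (suc _) = _

    S : Speeds (suc m)
    S = record { speed = oneFastSpeeds ; positive = oneFastSpeeds-pos }

    1≤speed : ∀ i → 1ℚ ≤ speed S i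
    1≤speed zero    = 1≤τ
    1≤speed (suc _) = ≤-refl

    module _ (alg : Algorithm (suc m)) where

      adversary : ℕ → Loads (suc m) → List ℚ
      adversary zero    L = []
      adversary (suc n) L with alg L
      ... | zero  = τ ∷ adversary n (addLoad S L zero τ)
      ... | suc _ = τ * τ ∷ []

      -- The k-th job from the end goes to machine k: no machine receives two jobs, and the
      -- job of size τ², always the last one, goes to the fast machine 0.
      schedule : ∀ n → n ℕ.≤ suc m → ∀ L → Assignment (suc m) (adversary n L)
      schedule zero    _   L = λ ()
      schedule (suc n) n<m L with alg L
      ... | zero  = fromℕ< n<m ∷ᵥ schedule n (ℕ.<⇒≤ n<m) (addLoad S L zero τ)
      ... | suc _ = λ _ → zero

      adversary-nonNeg : ∀ n L → All (0ℚ ≤_) (adversary n L)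
      adversary-nonNeg zero    L = []
      adversary-nonNeg (suc n) L with alg L
      ... | zero  = 0≤τ ∷ adversary-nonNeg n (addLoad S L zero τ)
      ... | suc _ = *-nonNeg 0≤τ 0≤τ ∷ []

      adversary-opt-pos : ∀ n L σ → 0ℚ < makespan S (adversary (suc n) L) σ
      adversary-opt-pos n L σ with alg L
      ... | zero  = makespan-pos S τ _ σ 0<τ (adversary-nonNeg n (addLoad S L zero τ))
      ... | suc _ = makespan-pos S (τ * τ) [] σ (positive⁻¹ (τ * τ) {{pos*pos⇒pos τ τ}}) []

      schedule-empty : ∀ n n≤m L i → n ℕ.≤ toℕ i → loadOf S (adversary n L) (schedule n n≤m L) i ≡ 0ℚ
      schedule-empty zero    _   L i       _   = refl
      schedule-empty (suc n) n<m L i       n<i with alg L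
      schedule-empty (suc n) n<m L i       n<i | zero with fromℕ< n<m ≟ i
      ... | yes refl = ⊥-elim (ℕ.<-irrefl (sym (Fin.toℕ-fromℕ< n<m)) n<i)
      ... | no  _    = schedule-empty n (ℕ.<⇒≤ n<m) (addLoad S L zero τ) i (ℕ.<⇒≤ n<i)
      schedule-empty (suc n) n<m L (suc i) n<i | suc _ = refl

      schedule-≤τ : ∀ n n≤m L i → loadOf S (adversary n L) (schedule n n≤m L) i ≤ τ
      schedule-≤τ zero    _   L i = 0≤τ
      schedule-≤τ (suc n) n<m L i with alg L
      schedule-≤τ (suc n) n<m L i | zero with fromℕ< n<m ≟ i
      ... | yes refl = begin
        time S i τ + loadOf S (adversary n L′) (schedule n (ℕ.<⇒≤ n<m) L′) i
          ≡⟨ cong (time S i τ +_) (schedule-empty n _ L′ i (ℕ.≤-reflexive (sym (Fin.toℕ-fromℕ< n<m)))) ⟩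
        time S i τ + 0ℚ
          ≡⟨ +-identityʳ (time S i τ) ⟩
        time S i τ
          ≤⟨ ≤speed*⇒time≤ S i τ≤sτ ⟩
        τ
          ∎
        where
        open ≤-Reasoning
        L′ = addLoad S L zero τ
        τ≤sτ : τ ≤ speed S i * τ
        τ≤sτ = subst (_≤ speed S i * τ) (*-identityˡ τ) (*-monoˡ-≤ 0≤τ (1≤speed i))
      ... | no  _    = schedule-≤τ n (ℕ.<⇒≤ n<m) (addLoad S L zero τ) i
      schedule-≤τ (suc n) n<m L zero    | suc _ = ≤-reflexive (trans (+-identityʳ _) (time-speed* S zero τ))
      schedule-≤τ (suc n) n<m L (suc i) | suc _ = 0≤τ

      Forced : ℕ → Loads (suc m) → Loads (suc m) → Set
      Forced n L X = (∃ λ r → L r + τ * τ ≤ X r) ⊎ (L zero + ofℕ n ≤ X zero)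

      adversary-forces : ∀ n L → Forced n L (run S alg L (adversary n L))
      adversary-forces zero    L = inj₂ (≤-reflexive (+-identityʳ (L zero)))
      adversary-forces (suc n) L with alg L in chosen
      ... | zero  rewrite chosen = step (adversary-forces n (addLoad S L zero τ))
        where
        step : ∀ {X} → Forced n (addLoad S L zero τ) X → Forced (suc n) L X
        step (inj₁ (r , L′r+τ²≤Xr)) =
          inj₁ (r , ≤-trans (+-monoˡ-≤ (τ * τ) (addLoad-≥ S L zero 0≤τ r)) L′r+τ²≤Xr)
        step (inj₂ L′₀+n≤X₀) = inj₂ (subst (_≤ _) L′₀+n≡L₀+[n+1] L′₀+n≤X₀)
          where
          L′₀+n≡L₀+[n+1] : addLoad S L zero τ zero + ofℕ n ≡ L zero + ofℕ (suc n)
          L′₀+n≡L₀+[n+1] = begin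
            addLoad S L zero τ zero + ofℕ n   ≡⟨ cong (_+ ofℕ n) (addLoad-≡ S L zero τ) ⟩
            L zero + time S zero τ + ofℕ n    ≡⟨ cong (λ x → L zero + x + ofℕ n) (*-inverseʳ τ {{pos⇒nonZero τ}}) ⟩
            L zero + 1ℚ + ofℕ n               ≡⟨ +-assoc (L zero) 1ℚ (ofℕ n) ⟩
            L zero + (1ℚ + ofℕ n)             ≡⟨ cong (L zero +_) (ofℕ-suc n) ⟨
            L zero + ofℕ (suc n)              ∎
            where open ≡-Reasoning
      ... | suc k rewrite chosen = inj₁ (suc k , ≤-reflexive (sym
        (trans (addLoad-≡ S L (suc k) (τ * τ)) (cong (L (suc k) +_) (*-identityʳ (τ * τ))))))

      jobs : List ℚ
      jobs = adversary (suc m) (λ _ → 0ℚ)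

      offline : Assignment (suc m) jobs
      offline = schedule (suc m) ℕ.≤-refl (λ _ → 0ℚ)

      offline-≤τ : makespan S jobs offline ≤ τ
      offline-≤τ = maxFin-lub 0≤τ (schedule-≤τ (suc m) ℕ.≤-refl (λ _ → 0ℚ))

      forced⇒large : ∀ {X} → Forced (suc m) (λ _ → 0ℚ) X → τ * τ ≤ maxFin X ⊎ ofℕ (suc m) ≤ maxFin X
      forced⇒large {X} (inj₁ (r , 0+τ²≤Xr)) =
        inj₁ (≤-trans (subst (_≤ X r) (+-identityˡ (τ * τ)) 0+τ²≤Xr) (f≤maxFin X r))
      forced⇒large {X} (inj₂ 0+m≤X₀) =
        inj₂ (≤-trans (subst (_≤ X zero) (+-identityˡ (ofℕ (suc m))) 0+m≤X₀) (f≤maxFin X zero))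

      alg-large : τ * τ ≤ algMakespan S alg jobs ⊎ ofℕ (suc m) ≤ algMakespan S alg jobs
      alg-large = forced⇒large (adversary-forces (suc m) (λ _ → 0ℚ))

  lower-bound : ∀ m → 1 ℕ.≤ m → ∃ λ (S : Speeds m) → (alg : Algorithm m) →
               ∃ λ (ps : List ℚ) → All (0ℚ ≤_) ps × ((σ : Assignment m ps) → 0ℚ < makespan S ps σ) ×
               ∃ λ (σ : Assignment m ps) →
               ofℕ m * (makespan S ps σ * makespan S ps σ)
                 ≤ ofℕ (2 ℕ.* 2) * (algMakespan S alg ps * algMakespan S alg ps)
  lower-bound (suc m) _ =
    let t , 1≤t , m<t² , t²≤4m = sqrt-bracket m
        open Adversary {m} (ofℕ t) (ofℕ-mono-≤ 1≤t)
    in  S , λ alg →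
          jobs alg , adversary-nonNeg alg (suc m) (λ _ → 0ℚ) , adversary-opt-pos alg m (λ _ → 0ℚ) , offline alg ,
          μ*q²≤4*a² (ofℕ-nonNeg (suc m)) (maxFin-nonNeg (loadOf S (jobs alg) (offline alg))) (offline-≤τ alg)
            (subst (ofℕ (suc m) ≤_) (ofℕ-* t t) (ofℕ-mono-≤ m<t²))
            (subst₂ _≤_ (ofℕ-* t t) (ofℕ-* 4 (suc m)) (ofℕ-mono-≤ t²≤4m))
            (alg-large alg)

open import Defs
open import Data.Nat using (ℕ; _≤_)
open import Data.Product using (_×_; ∃; _,_)
open import Data.List using (List)
open import Data.List.Relation.Unary.All using (All)
open import Data.Rational using (ℚ; 0ℚ; _*_)
open import Data.Rational as Q using ()
open ClairvoyanceGap using (upper-bound; lower-bound)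

theorem6 :
    (∃ λ (C : ℕ) → ∀ (m : ℕ) → 1 ≤ m → (S : Speeds m) → ∃ λ (alg : Algorithm m) →
      ∀ (ps : List ℚ) → All (0ℚ Q.≤_) ps → (σ : Assignment m ps) →
        algMakespan S alg ps * algMakespan S alg ps
          Q.≤ (ofℕ (C Data.Nat.* C Data.Nat.* m)) * (makespan S ps σ * makespan S ps σ))
    ×
    (∃ λ (k : ℕ) → ∀ (m : ℕ) → 1 ≤ m → ∃ λ (S : Speeds m) → (alg : Algorithm m) →
      ∃ λ (ps : List ℚ) → All (0ℚ Q.≤_) ps × ((σ : Assignment m ps) → 0ℚ Q.< makespan S ps σ) ×
        ∃ λ (σ : Assignment m ps) →
          ofℕ m * (makespan S ps σ * makespan S ps σ)
            Q.≤ ofℕ (k Data.Nat.* k) * (algMakespan S alg ps * algMakespan S alg ps))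
theorem6 = (6 , upper-bound) , (2 , lower-bound)
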